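{- Let $M=\{\!\{m_1,\ldots,m_k\}\!\}$ be a multiset of even positive integers admitting a partition into multisets $P_1,\ldots,P_\ell$ such that: (i) $\ell=2^a$ for some positive integer $a$; (ii) $\sum_{m\in P_i}m=\sum_{m\in P_j}m$ for all $i,j\in\{1,\ldots,\ell\}$; (iii) for each $i$, if $P_i=\{\!\{m_{1,i},\ldots,m_{k_i,i}\}\!\}$, then $\mathrm{OP}^\ast(m_{1,i},\ldots,m_{k_i,i})$ has a solution. Then $\mathrm{OP}^\ast(m_1,\ldots,m_k)$ has a solution.
   Context: $K_n^\ast$ is the complete symmetric digraph of order $n$. $\mathrm{OP}^\ast(m_1,\ldots,m_k)$ (with $n=m_1+\ldots+m_k$) asks for a decomposition of $K_n^\ast$ into spanning subdigraphs each a disjoint union of $k$ directed cycles of lengths $m_1,\ldots,m_k$ (a solution). $\{\!\{\cdot\}\!\}$ denotes a multiset. -}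

module Defs where

open import Data.Nat using (ℕ; zero; suc; _<_; _^_)
open import Data.Nat.DivMod using (_mod_)
open import Data.Nat.Divisibility using (_∣_)
open import Data.Fin using (Fin; toℕ)
open import Data.List using (List; length; lookup; concat)
open import Data.Nat.ListAction using (sum)
open import Data.List.Relation.Unary.All using (All)
open import Data.List.Relation.Binary.Permutation.Propositional using (_↭_)
open import Data.Vec using (Vec; toList)
open import Data.Product using (Σ; ∃; _×_; _,_)
open import Function.Bundles using (_⤖_; Bijection)
open import Relation.Binary.PropositionalEquality using (_≡_; _≢_)
open import Relation.Nullary using (¬_)

next : ∀ {m} → Fin m → Fin m
next {suc m} j = suc (toℕ j) mod (suc m)

-- Positions of a disjoint union of directed cycles of lengths ms:
-- position (i , j) is the j-th vertex of the i-th cycle (which has length lookup ms i).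
Pos : List ℕ → Set
Pos ms = Σ (Fin (length ms)) (λ i → Fin (lookup ms i))

-- A spanning subdigraph of K_n^* (n = sum ms) which is a disjoint union of directed
-- cycles of lengths m_1, …, m_k: a bijection between the cycle positions and the vertex set.
-- (Vertex-disjointness and spanning are exactly bijectivity.)
CycleFactor : List ℕ → Set
CycleFactor ms = Pos ms ⤖ Fin (sum ms)

Arc : ∀ ms → CycleFactor ms → Fin (sum ms) → Fin (sum ms) → Set
Arc ms F u v =
  ∃ λ (i : Fin (length ms)) → ∃ λ (j : Fin (lookup ms i)) →
    (Bijection.to F (i , j) ≡ u) × (Bijection.to F (i , next j) ≡ v)

-- OP*(m_1,…,m_k) has a solution: a decomposition of the arc set of K_n^*
-- (n = m_1+…+m_k, vertices Fin n, arcs = ordered pairs of distinct vertices)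
-- into (any number t of) factors each a disjoint union of directed cycles of
-- lengths m_1,…,m_k: no factor contains a loop, and every arc u → v (u ≢ v)
-- lies in exactly one factor.
OPStar : List ℕ → Set
OPStar ms =
  ∃ λ (t : ℕ) → ∃ λ (F : Fin t → CycleFactor ms) →
    (∀ s u → ¬ Arc ms (F s) u u) ×
    (∀ u v → u ≢ v →
      ∃ λ s → Arc ms (F s) u v × (∀ s′ → Arc ms (F s′) u v → s′ ≡ s))

-- Let A and B be lists of even cycle lengths, each summing to n, with OP*(A) and OP*(B)
-- solvable.  Take the vertices of K_{2n}^* to be two copies X × {false, true} of X = Z_n.  Both
-- solutions have n − 1 factors (factors × positions enumerate the n(n − 1) arcs), so running the
-- s-th factor for A on the first copy and the s-th factor for B on the second gives n − 1 factors of
-- type A ++ B using every arc inside a copy.  Because all cycles are even, the positions of A ++ B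
-- can be coloured by X × Bool so that (x , false) is followed by (x , true), which is followed by
-- (step x , false); sending colour (x , b) to vertex (x , b) and then translating the second copy by
-- d ∈ Z_n gives n further factors, which use every arc between the copies exactly once.  Merging
-- the 2^a parts pairwise, a times, proves the corollary.

module Submission where

open import Data.Bool using (Bool; true; false; not)
open import Data.Bool.Properties using (not-¬)
open import Data.Empty using (⊥; ⊥-elim; ⊥-elim-irr)
open import Data.Fin using (Fin; zero; suc; toℕ; combine; _≟_)
open import Data.Fin.Permutation using (cast-id; ↔⇒≡)
open import Data.Fin.Properties
  using (¬Fin0; 0↔⊥; 2↔Bool; +↔⊎; *↔×; toℕ-combine; toℕ-fromℕ<; toℕ-injective; toℕ≤n; toℕ<n)
open import Data.List using (List; []; _∷_; _++_; length; concat; take; drop)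
open import Data.List.Properties using (length-take; length-drop; take++drop≡id; concat-++; ++-identityʳ)
open import Data.List.Relation.Binary.Permutation.Propositional as ↭ using (_↭_)
open import Data.List.Relation.Binary.Permutation.Propositional.Properties using (All-resp-↭)
open import Data.List.Relation.Unary.All as All using (All; []; _∷_)
open import Data.List.Relation.Unary.All.Properties using (++⁺; concat⁻; take⁺; drop⁺)
open import Data.Nat using (ℕ; zero; suc; _+_; _*_; _∸_; _%_; _<_; _^_; _⊓_; NonZero)
open import Data.Nat.Divisibility using (_∣_; divides)
open import Data.Nat.DivMod
  using (_mod_; m%n<n; m%n%n≡m%n; [m+n]%n≡m%n; m<n⇒m%n≡m; %-distribˡ-+; m%n*o≡m*o%[n*o])
open import Data.Nat.ListAction using (sum)
open import Data.Nat.ListAction.Properties using (sum-↭; sum-++)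
open import Data.Nat.Properties
  using (+-assoc; +-comm; +-identityʳ; *-distribʳ-+; *-cancelʳ-≡; m∸n+n≡m; m+[n∸m]≡n; m+n∸m≡n;
         m≤m+n; m≤n⇒m⊓n≡m)
open import Data.Nat.Tactic.RingSolver using (solve-∀)
open import Data.Product using (_×_; ∃; ∃₂; _,_; proj₁; proj₂)
import Data.Product as Product
open import Data.Product.Function.NonDependent.Propositional using (_×-↔_)
open import Data.Sum using (_⊎_; inj₁; inj₂; [_,_])
import Data.Sum as Sum
open import Data.Sum.Algebra using (⊎-assoc)
open import Data.Sum.Function.Propositional using (_⊎-↔_)
open import Data.Vec using (Vec; toList; lookup; []; _∷_)
open import Data.Vec.Properties using (length-toList)
open import Function.Base using (_∘_)
open import Function.Bundles using (_↔_; Inverse; Injection; mk↔ₛ′)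
open import Function.Properties.Bijection using (⤖⇒↔)
open import Function.Properties.Inverse using (↔-refl; ↔-sym; ↔-trans; ↔⇒↣; ↔⇒⤖)
open import Level using (0ℓ)
open import Relation.Binary using (DecidableEquality)
open import Relation.Binary.PropositionalEquality
  using (_≡_; _≢_; refl; sym; trans; cong; cong₂; subst; subst₂; module ≡-Reasoning)
open import Relation.Nullary using (Dec; yes; no)

open import Defs

open Inverse using (to; from; strictlyInverseˡ; strictlyInverseʳ)

to-injective : ∀ {A B : Set} (φ : A ↔ B) {a a′} → to φ a ≡ to φ a′ → a ≡ a′
to-injective φ = Injection.injective (↔⇒↣ φ)

record Conjugacy {P Q : Set} (σ : P → P) (τ : Q → Q) : Set where
  field
    iso      : P ↔ Q
    commutes : ∀ p → to iso (σ p) ≡ τ (to iso p)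

open Conjugacy

conj-refl : ∀ {P : Set} {σ : P → P} → Conjugacy σ σ
conj-refl = record { iso = ↔-refl ; commutes = λ _ → refl }

module _ {P Q : Set} {σ : P → P} {τ : Q → Q} where

  conj-sym : Conjugacy σ τ → Conjugacy τ σ
  conj-sym c = record { iso = ↔-sym (iso c) ; commutes = commutes-sym }
    where
    open ≡-Reasoning
    commutes-sym : ∀ q → from (iso c) (τ q) ≡ σ (from (iso c) q)
    commutes-sym q = begin
      from (iso c) (τ q)                       ≡⟨ cong (λ q′ → from (iso c) (τ q′)) (strictlyInverseˡ (iso c) q) ⟨
      from (iso c) (τ (to (iso c) (from (iso c) q))) ≡⟨ cong (from (iso c)) (commutes c (from (iso c) q)) ⟨
      from (iso c) (to (iso c) (σ (from (iso c) q))) ≡⟨ strictlyInverseʳ (iso c) _ ⟩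
      σ (from (iso c) q)                       ∎

module _ {P Q R : Set} {σ : P → P} {τ : Q → Q} {υ : R → R} where

  conj-trans : Conjugacy σ τ → Conjugacy τ υ → Conjugacy σ υ
  conj-trans c d = record
    { iso      = ↔-trans (iso c) (iso d)
    ; commutes = λ p → trans (cong (to (iso d)) (commutes c p)) (commutes d (to (iso c) p)) }

module _ {P P′ Q Q′ : Set} {σ : P → P} {σ′ : P′ → P′} {τ : Q → Q} {τ′ : Q′ → Q′} where

  conj-⊎ : Conjugacy σ τ → Conjugacy σ′ τ′ → Conjugacy (Sum.map σ σ′) (Sum.map τ τ′)
  conj-⊎ c c′ = record
    { iso      = iso c ⊎-↔ iso c′
    ; commutes = λ { (inj₁ p) → cong inj₁ (commutes c p) ; (inj₂ p) → cong inj₂ (commutes c′ p) } }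

module _ {P Q R : Set} {σ : P → P} {τ : Q → Q} {υ : R → R} where

  conj-⊎-assoc : Conjugacy (Sum.map σ (Sum.map τ υ)) (Sum.map (Sum.map σ τ) υ)
  conj-⊎-assoc = record
    { iso      = ↔-sym (⊎-assoc 0ℓ P Q R)
    ; commutes = λ { (inj₁ p) → refl ; (inj₂ (inj₁ q)) → refl ; (inj₂ (inj₂ r)) → refl } }

  conj-⊎-swapˡ : Conjugacy (Sum.map σ (Sum.map τ υ)) (Sum.map τ (Sum.map σ υ))
  conj-⊎-swapˡ = record
    { iso      = mk↔ₛ′ swapˡ swapˡ involutive involutive
    ; commutes = λ { (inj₁ p) → refl ; (inj₂ (inj₁ q)) → refl ; (inj₂ (inj₂ r)) → refl } }
    where
    swapˡ : ∀ {A B C : Set} → A ⊎ (B ⊎ C) → B ⊎ (A ⊎ C)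
    swapˡ (inj₁ a)        = inj₂ (inj₁ a)
    swapˡ (inj₂ (inj₁ b)) = inj₁ b
    swapˡ (inj₂ (inj₂ c)) = inj₂ (inj₂ c)
    involutive : ∀ {A B C : Set} (x : A ⊎ (B ⊎ C)) → swapˡ (swapˡ x) ≡ x
    involutive (inj₁ a)        = refl
    involutive (inj₂ (inj₁ b)) = refl
    involutive (inj₂ (inj₂ c)) = refl

-- Pos ms laid out as a sum, so that appending and permuting cycle lists become ⊎-isomorphisms.
Cycles : List ℕ → Set
Cycles []       = ⊥
Cycles (m ∷ ms) = Fin m ⊎ Cycles ms

rotate : ∀ ms → Cycles ms → Cycles ms
rotate []       = λ ()
rotate (m ∷ ms) = Sum.map next (rotate ms)

nextPos : ∀ ms → Pos ms → Pos ms
nextPos _ (i , j) = i , next j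

Pos-uncons : ∀ m ms → Conjugacy (nextPos (m ∷ ms)) (Sum.map next (nextPos ms))
Pos-uncons m ms = record
  { iso      = mk↔ₛ′ uncons cons (λ { (inj₁ j) → refl ; (inj₂ p) → refl })
                                 (λ { (zero , j) → refl ; (suc i , j) → refl })
  ; commutes = λ { (zero , j) → refl ; (suc i , j) → refl } }
  where
  uncons : Pos (m ∷ ms) → Fin m ⊎ Pos ms
  uncons (zero  , j) = inj₁ j
  uncons (suc i , j) = inj₂ (i , j)
  cons : Fin m ⊎ Pos ms → Pos (m ∷ ms)
  cons (inj₁ j)       = zero , j
  cons (inj₂ (i , j)) = suc i , j

Pos≅Cycles : ∀ ms → Conjugacy (nextPos ms) (rotate ms)
Pos≅Cycles []       = record
  { iso = mk↔ₛ′ (λ { (() , _) }) (λ ()) (λ ()) (λ { (() , _) }) ; commutes = λ { (() , _) } }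
Pos≅Cycles (m ∷ ms) = conj-trans (Pos-uncons m ms) (conj-⊎ conj-refl (Pos≅Cycles ms))

Cycles-++ : ∀ A B → Conjugacy (rotate (A ++ B)) (Sum.map (rotate A) (rotate B))
Cycles-++ []      B = record
  { iso      = mk↔ₛ′ inj₂ (λ { (inj₁ ()) ; (inj₂ p) → p }) (λ { (inj₁ ()) ; (inj₂ p) → refl }) (λ _ → refl)
  ; commutes = λ _ → refl }
Cycles-++ (m ∷ A) B = conj-trans (conj-⊎ conj-refl (Cycles-++ A B)) conj-⊎-assoc

Cycles-↭ : ∀ {xs ys} → xs ↭ ys → Conjugacy (rotate xs) (rotate ys)
Cycles-↭ ↭.refl          = conj-refl
Cycles-↭ (↭.prep x r)    = conj-⊎ conj-refl (Cycles-↭ r)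
Cycles-↭ (↭.swap x y r)  = conj-trans conj-⊎-swapˡ (conj-⊎ conj-refl (conj-⊎ conj-refl (Cycles-↭ r)))
Cycles-↭ (↭.trans r r′)  = conj-trans (Cycles-↭ r) (Cycles-↭ r′)

Cycles↔Fin : ∀ ms → Cycles ms ↔ Fin (sum ms)
Cycles↔Fin []       = ↔-sym 0↔⊥
Cycles↔Fin (m ∷ ms) = ↔-trans (↔-refl ⊎-↔ Cycles↔Fin ms) (↔-sym +↔⊎)

-- OP* with the positions P (successor σ), the vertices V and the factor indices T made arbitrary.
record Decomposition (P : Set) (σ : P → P) (V T : Set) : Set where
  field
    factor   : T → P ↔ V
    loopless : ∀ s p → to (factor s) p ≢ to (factor s) (σ p)
    covers   : ∀ {u v} → u ≢ v → ∃₂ λ s p → to (factor s) p ≡ u × to (factor s) (σ p) ≡ v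
    disjoint : ∀ {s s′ p p′} → to (factor s) p ≡ to (factor s′) p′ →
               to (factor s) (σ p) ≡ to (factor s′) (σ p′) → s ≡ s′

open Decomposition

module _ {P V T : Set} {σ : P → P} (D : Decomposition P σ V T) where

  reindex : ∀ {T′} → T ↔ T′ → Decomposition P σ V T′
  reindex τ = record
    { factor   = λ s → factor D (from τ s)
    ; loopless = λ s → loopless D (from τ s)
    ; covers   = λ u≢v → let s , p , p↦u , σp↦v = covers D u≢v in
        to τ s , p , trans (cong (λ s → to (factor D s) p) (strictlyInverseʳ τ s)) p↦u ,
                     trans (cong (λ s → to (factor D s) (σ p)) (strictlyInverseʳ τ s)) σp↦v
    ; disjoint = λ p≡p′ σp≡σp′ → to-injective (↔-sym τ) (disjoint D p≡p′ σp≡σp′) }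

  relabel : ∀ {V′} → V ↔ V′ → Decomposition P σ V′ T
  relabel ψ = record
    { factor   = λ s → ↔-trans (factor D s) ψ
    ; loopless = λ s p e → loopless D s p (to-injective ψ e)
    ; covers   = λ {u} {v} u≢v →
        let s , p , p↦u , σp↦v = covers D (λ e → u≢v (to-injective (↔-sym ψ) e)) in
        s , p , trans (cong (to ψ) p↦u) (strictlyInverseˡ ψ u) ,
                trans (cong (to ψ) σp↦v) (strictlyInverseˡ ψ v)
    ; disjoint = λ p≡p′ σp≡σp′ → disjoint D (to-injective ψ p≡p′) (to-injective ψ σp≡σp′) }

  reposition : ∀ {P′} {σ′ : P′ → P′} → Conjugacy σ′ σ → Decomposition P′ σ′ V T
  reposition {σ′ = σ′} c = record
    { factor   = λ s → ↔-trans (iso c) (factor D s)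
    ; loopless = λ s p e → loopless D s (to (iso c) p) (trans e (σ-after s p))
    ; covers   = λ u≢v → let s , p , p↦u , σp↦v = covers D u≢v in
        s , from (iso c) p ,
        trans (cong (to (factor D s)) (strictlyInverseˡ (iso c) p)) p↦u ,
        trans (σ-after s (from (iso c) p))
              (trans (cong (λ q → to (factor D s) (σ q)) (strictlyInverseˡ (iso c) p)) σp↦v)
    ; disjoint = λ {s} {s′} {p} {p′} p≡p′ σp≡σp′ → disjoint D p≡p′
        (trans (sym (σ-after s p)) (trans σp≡σp′ (σ-after s′ p′))) }
    where
    σ-after : ∀ s p → to (factor D s) (to (iso c) (σ′ p)) ≡ to (factor D s) (σ (to (iso c) p))
    σ-after s p = cong (to (factor D s)) (commutes c p)

module _ (ms : List ℕ) where

  OPStar⇒Decomposition : OPStar ms → ∃ λ t → Decomposition (Cycles ms) (rotate ms) (Fin (sum ms)) (Fin t)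
  OPStar⇒Decomposition (t , F , loopFree , uniqueFactor) = t , reposition D (conj-sym (Pos≅Cycles ms))
    where
    D : Decomposition (Pos ms) (nextPos ms) (Fin (sum ms)) (Fin t)
    D = record
      { factor   = λ s → ⤖⇒↔ (F s)
      ; loopless = λ { s (i , j) e → loopFree s _ (i , j , refl , sym e) }
      ; covers   = λ u≢v → let s , (i , j , e , e′) , _ = uniqueFactor _ _ u≢v in s , (i , j) , e , e′
      ; disjoint = λ { {s} {s′} {i , j} {i′ , j′} e e′ →
          let _ , _ , unique = uniqueFactor _ _ (λ e″ → loopFree s _ (i , j , refl , sym e″)) in
          trans (unique s (i , j , refl , refl)) (sym (unique s′ (i′ , j′ , sym e , sym e′))) } }

  Decomposition⇒OPStar : ∀ {t} → Decomposition (Cycles ms) (rotate ms) (Fin (sum ms)) (Fin t) → OPStar ms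
  Decomposition⇒OPStar {t} D′ =
    t , (λ s → ↔⇒⤖ (factor D s)) ,
    (λ { s u (i , j , e , e′) → loopless D s (i , j) (trans e (sym e′)) }) ,
    λ u v u≢v → let s , (i , j) , e , e′ = covers D u≢v in
      s , (i , j , e , e′) ,
      λ { s′ (i′ , j′ , e″ , e‴) → disjoint D (trans e″ (sym e)) (trans e‴ (sym e′)) }
    where
    D : Decomposition (Pos ms) (nextPos ms) (Fin (sum ms)) (Fin t)
    D = reposition D′ (Pos≅Cycles ms)

OPStar-resp-↭ : ∀ {xs ys} → xs ↭ ys → OPStar xs → OPStar ys
OPStar-resp-↭ {xs} {ys} xs↭ys op =
  let _ , D = OPStar⇒Decomposition xs op in
  Decomposition⇒OPStar ys (relabel (reposition D (conj-sym (Cycles-↭ xs↭ys))) (cast-id (sum-↭ xs↭ys)))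

-- The proof is irrelevant, so pairs with equal endpoints are equal without function extensionality.
record DistinctPair (V : Set) : Set where
  constructor distinct
  field
    source target   : V
    .source≢target  : source ≢ target

distinct-cong : ∀ {V : Set} {u u′ v v′ : V} .{u≢v : u ≢ v} .{u′≢v′ : u′ ≢ v′} →
                u ≡ u′ → v ≡ v′ → distinct u v u≢v ≡ distinct u′ v′ u′≢v′
distinct-cong refl refl = refl

module _ {P V T : Set} {σ : P → P} (_≟_ : DecidableEquality V) (D : Decomposition P σ V T) where

  private
    arc : T × P → DistinctPair V
    arc (s , p) = distinct (to (factor D s) p) (to (factor D s) (σ p)) (loopless D s p)

    locate′ : ∀ u v → .(u ≢ v) → Dec (u ≡ v) → T × P
    locate′ u v u≢v (yes u≡v) = ⊥-elim-irr (u≢v u≡v)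
    locate′ u v _   (no u≢v)  = let s , p , _ = covers D u≢v in s , p

    arc-locate′ : ∀ u v .(u≢v : u ≢ v) d → arc (locate′ u v u≢v d) ≡ distinct u v u≢v
    arc-locate′ u v u≢v (yes u≡v) = ⊥-elim-irr (u≢v u≡v)
    arc-locate′ u v _   (no u≢v)  = let _ , _ , p↦u , σp↦v = covers D u≢v in distinct-cong p↦u σp↦v

    -- An irrelevant u ≢ v cannot be handed to covers, so it is re-decided.
    locate : DistinctPair V → T × P
    locate (distinct u v u≢v) = locate′ u v u≢v (u ≟ v)

    locate-arc : ∀ sp → locate (arc sp) ≡ sp
    locate-arc (s , p) with to (factor D s) p ≟ to (factor D s) (σ p)
    ... | yes loop = ⊥-elim (loopless D s p loop)
    ... | no u≢v with covers D u≢v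
    ...   | s′ , p′ , p′↦u , σp′↦v with disjoint D p′↦u σp′↦v
    ...     | refl = cong (s ,_) (to-injective (factor D s) p′↦u)

  arcs↔ : (T × P) ↔ DistinctPair V
  arcs↔ = mk↔ₛ′ arc locate (λ { (distinct u v u≢v) → arc-locate′ u v u≢v (u ≟ v) }) locate-arc

factorCount-unique : ∀ {PA PB : Set} {σA : PA → PA} {σB : PB → PB} {n tA tB} .{{_ : NonZero n}} →
  Decomposition PA σA (Fin n) (Fin tA) → Decomposition PB σB (Fin n) (Fin tB) →
  PA ↔ Fin n → PB ↔ Fin n → tA ≡ tB
factorCount-unique {n = n} {tA} {tB} DA DB PA↔Fin PB↔Fin =
  *-cancelʳ-≡ tA tB n (↔⇒≡ (↔-trans (countArcs DA PA↔Fin) (↔-sym (countArcs DB PB↔Fin))))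
  where
  countArcs : ∀ {P : Set} {σ : P → P} {t} → Decomposition P σ (Fin n) (Fin t) →
              P ↔ Fin n → Fin (t * n) ↔ DistinctPair (Fin n)
  countArcs D P↔Fin = ↔-trans *↔× (↔-trans (↔-refl ×-↔ ↔-sym P↔Fin) (arcs↔ _≟_ D))

toℕ-next : ∀ {m} (j : Fin (suc m)) → toℕ (next j) ≡ suc (toℕ j) % suc m
toℕ-next {m} j = toℕ-fromℕ< (m%n<n (suc (toℕ j)) (suc m))

record LatinSquare (X : Set) : Set where
  field
    row               : X → X ↔ X
    column-injective  : ∀ x {d d′} → to (row d) x ≡ to (row d′) x → d ≡ d′
    column-surjective : ∀ x y → ∃ λ d → to (row d) x ≡ y

module Cyclic (k : ℕ) where

  N : ℕ
  N = suc k

  infixl 6 _⊕_ _⊖_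

  _⊕_ : Fin N → Fin N → Fin N
  x ⊕ y = (toℕ x + toℕ y) mod N

  _⊖_ : Fin N → Fin N → Fin N
  y ⊖ x = (N ∸ toℕ x + toℕ y) mod N

  toℕ-mod : ∀ m → toℕ (m mod N) ≡ m % N
  toℕ-mod m = toℕ-fromℕ< (m%n<n m N)

  [m+n%N]%N≡[m+n]%N : ∀ m n → (m + n % N) % N ≡ (m + n) % N
  [m+n%N]%N≡[m+n]%N m n = begin
    (m + n % N) % N           ≡⟨ %-distribˡ-+ m (n % N) N ⟩
    (m % N + n % N % N) % N   ≡⟨ cong (λ r → (m % N + r) % N) (m%n%n≡m%n n N) ⟩
    (m % N + n % N) % N       ≡⟨ %-distribˡ-+ m n N ⟨
    (m + n) % N               ∎
    where open ≡-Reasoning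

  %-wrap : ∀ a b c → a + b ≡ N → c < N → (a + (b + c) % N) % N ≡ c
  %-wrap a b c a+b≡N c<N = begin
    (a + (b + c) % N) % N  ≡⟨ [m+n%N]%N≡[m+n]%N a (b + c) ⟩
    (a + (b + c)) % N      ≡⟨ cong (_% N) (+-assoc a b c) ⟨
    (a + b + c) % N        ≡⟨ cong (λ n → (n + c) % N) a+b≡N ⟩
    (N + c) % N            ≡⟨ cong (_% N) (+-comm N c) ⟩
    (c + N) % N            ≡⟨ [m+n]%n≡m%n c N ⟩
    c % N                  ≡⟨ m<n⇒m%n≡m c<N ⟩
    c                      ∎
    where open ≡-Reasoning

  ⊕-comm : ∀ x y → x ⊕ y ≡ y ⊕ x
  ⊕-comm x y = cong (_mod N) (+-comm (toℕ x) (toℕ y))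

  ⊖-⊕ : ∀ x d → (x ⊕ d) ⊖ x ≡ d
  ⊖-⊕ x d = toℕ-injective (begin
    toℕ ((x ⊕ d) ⊖ x)                        ≡⟨ toℕ-mod (N ∸ toℕ x + toℕ (x ⊕ d)) ⟩
    (N ∸ toℕ x + toℕ (x ⊕ d)) % N            ≡⟨ cong (λ r → (N ∸ toℕ x + r) % N) (toℕ-mod (toℕ x + toℕ d)) ⟩
    (N ∸ toℕ x + (toℕ x + toℕ d) % N) % N    ≡⟨ %-wrap (N ∸ toℕ x) (toℕ x) (toℕ d) (m∸n+n≡m (toℕ≤n x)) (toℕ<n d) ⟩
    toℕ d                                     ∎)
    where open ≡-Reasoning

  ⊕-⊖ : ∀ x y → x ⊕ (y ⊖ x) ≡ y
  ⊕-⊖ x y = toℕ-injective (begin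
    toℕ (x ⊕ (y ⊖ x))                        ≡⟨ toℕ-mod (toℕ x + toℕ (y ⊖ x)) ⟩
    (toℕ x + toℕ (y ⊖ x)) % N                ≡⟨ cong (λ r → (toℕ x + r) % N) (toℕ-mod (N ∸ toℕ x + toℕ y)) ⟩
    (toℕ x + (N ∸ toℕ x + toℕ y) % N) % N    ≡⟨ %-wrap (toℕ x) (N ∸ toℕ x) (toℕ y) (m+[n∸m]≡n (toℕ≤n x)) (toℕ<n y) ⟩
    toℕ y                                     ∎)
    where open ≡-Reasoning

  next≡⊕1 : ∀ x → next x ≡ x ⊕ (1 mod N)
  next≡⊕1 x = toℕ-injective (begin
    toℕ (next x)                  ≡⟨ toℕ-next x ⟩
    suc (toℕ x) % N               ≡⟨ cong (_% N) (+-comm 1 (toℕ x)) ⟩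
    (toℕ x + 1) % N               ≡⟨ [m+n%N]%N≡[m+n]%N (toℕ x) 1 ⟨
    (toℕ x + 1 % N) % N           ≡⟨ cong (λ r → (toℕ x + r) % N) (toℕ-mod 1) ⟨
    (toℕ x + toℕ (1 mod N)) % N   ≡⟨ toℕ-mod (toℕ x + toℕ (1 mod N)) ⟨
    toℕ (x ⊕ (1 mod N))           ∎)
    where open ≡-Reasoning

  cyclicLatinSquare : LatinSquare (Fin N)
  cyclicLatinSquare = record
    { row               = λ d → mk↔ₛ′ (_⊕ d) (_⊖ d)
                            (λ y → trans (⊕-comm _ d) (⊕-⊖ d y))
                            (λ x → trans (cong (_⊖ d) (⊕-comm x d)) (⊖-⊕ d x))
    ; column-injective  = λ x {d} {d′} x⊕d≡x⊕d′ →
        trans (sym (⊖-⊕ x d)) (trans (cong (_⊖ x) x⊕d≡x⊕d′) (⊖-⊕ x d′))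
    ; column-surjective = λ x y → y ⊖ x , ⊕-⊖ x y }

alternate : ∀ {X : Set} → (X → X) → X × Bool → X × Bool
alternate τ (x , false) = x , true
alternate τ (x , true)  = τ x , false

record Alternating {P : Set} (σ : P → P) (X : Set) : Set where
  field
    step      : X ↔ X
    colouring : Conjugacy σ (alternate (to step))

open Alternating

alternating-∅ : ∀ {P : Set} {σ : P → P} → (P → ⊥) → Alternating σ (Fin 0)
alternating-∅ ¬p = record
  { step      = ↔-refl
  ; colouring = record
    { iso = mk↔ₛ′ (λ p → ⊥-elim (¬p p)) (λ { (() , _) }) (λ { (() , _) }) (λ p → ⊥-elim (¬p p))
    ; commutes = λ p → ⊥-elim (¬p p) } }

alternating-cycle : ∀ q → Alternating (next {q * 2}) (Fin q)
alternating-cycle zero    = alternating-∅ λ ()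
alternating-cycle (suc q) = record { step = row (1 mod N) ; colouring = conj-sym parity-conj }
  where
  open Cyclic q
  open LatinSquare cyclicLatinSquare
  open ≡-Reasoning

  -- Position 2x + b of the cycle gets colour (x , b).
  parity : Fin (N * 2) ↔ (Fin N × Bool)
  parity = ↔-trans *↔× (↔-refl ×-↔ 2↔Bool)

  suc[2x+0]≡2x+1 : ∀ x → suc (2 * x + 0) ≡ 2 * x + 1
  suc[2x+0]≡2x+1 = solve-∀
  suc[2x+1]≡[1+x]*2 : ∀ x → suc (2 * x + 1) ≡ suc x * 2
  suc[2x+1]≡[1+x]*2 = solve-∀
  x*2≡2x+0 : ∀ x → x * 2 ≡ 2 * x + 0
  x*2≡2x+0 = solve-∀

  even↦odd : ∀ x → combine {N} {2} x (suc zero) ≡ next (combine x zero)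
  even↦odd x = toℕ-injective (begin
    toℕ (combine x (suc zero))          ≡⟨ m<n⇒m%n≡m (toℕ<n (combine {N} {2} x (suc zero))) ⟨
    toℕ (combine x (suc zero)) % (N * 2) ≡⟨ cong (_% (N * 2)) (toℕ-combine x (suc zero)) ⟩
    (2 * toℕ x + 1) % (N * 2)           ≡⟨ cong (_% (N * 2)) (suc[2x+0]≡2x+1 (toℕ x)) ⟨
    suc (2 * toℕ x + 0) % (N * 2)       ≡⟨ cong (λ n → suc n % (N * 2)) (toℕ-combine x zero) ⟨
    suc (toℕ (combine x zero)) % (N * 2) ≡⟨ toℕ-next (combine x zero) ⟨
    toℕ (next (combine x zero))         ∎)

  odd↦even : ∀ x → combine {N} {2} (x ⊕ (1 mod N)) zero ≡ next (combine x (suc zero))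
  odd↦even x = toℕ-injective (begin
    toℕ (combine (x ⊕ (1 mod N)) zero)  ≡⟨ cong (λ y → toℕ (combine {N} {2} y zero)) (next≡⊕1 x) ⟨
    toℕ (combine (next x) zero)         ≡⟨ toℕ-combine (next x) zero ⟩
    2 * toℕ (next x) + 0                ≡⟨ cong (λ n → 2 * n + 0) (toℕ-next x) ⟩
    2 * (suc (toℕ x) % N) + 0           ≡⟨ x*2≡2x+0 (suc (toℕ x) % N) ⟨
    suc (toℕ x) % N * 2                 ≡⟨ m%n*o≡m*o%[n*o] (suc (toℕ x)) N 2 ⟩
    suc (toℕ x) * 2 % (N * 2)           ≡⟨ cong (_% (N * 2)) (suc[2x+1]≡[1+x]*2 (toℕ x)) ⟨
    suc (2 * toℕ x + 1) % (N * 2)       ≡⟨ cong (λ n → suc n % (N * 2)) (toℕ-combine x (suc zero)) ⟨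
    suc (toℕ (combine x (suc zero))) % (N * 2) ≡⟨ toℕ-next (combine x (suc zero)) ⟨
    toℕ (next (combine x (suc zero)))   ∎)

  parity-conj : Conjugacy (alternate (to (row (1 mod N)))) (next {N * 2})
  parity-conj = record
    { iso      = ↔-sym parity
    ; commutes = λ { (x , false) → even↦odd x ; (x , true) → odd↦even x } }

module _ {X Y : Set} {τ : X → X} {υ : Y → Y} where

  alternate-⊎ : Conjugacy (Sum.map (alternate τ) (alternate υ)) (alternate (Sum.map τ υ))
  alternate-⊎ = record
    { iso      = mk↔ₛ′ distrib factorise
                   (λ { (inj₁ x , b) → refl ; (inj₂ y , b) → refl })
                   (λ { (inj₁ (x , b)) → refl ; (inj₂ (y , b)) → refl })
    ; commutes = λ { (inj₁ (x , false)) → refl ; (inj₁ (x , true)) → refl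
                   ; (inj₂ (y , false)) → refl ; (inj₂ (y , true)) → refl } }
    where
    distrib : (X × Bool) ⊎ (Y × Bool) → (X ⊎ Y) × Bool
    distrib = [ Product.map₁ inj₁ , Product.map₁ inj₂ ]
    factorise : (X ⊎ Y) × Bool → (X × Bool) ⊎ (Y × Bool)
    factorise (inj₁ x , b) = inj₁ (x , b)
    factorise (inj₂ y , b) = inj₂ (y , b)

  alternate-conj : (ψ : X ↔ Y) → (∀ x → to ψ (τ x) ≡ υ (to ψ x)) →
                   Conjugacy (alternate τ) (alternate υ)
  alternate-conj ψ ψ∘τ≡υ∘ψ = record
    { iso      = ψ ×-↔ ↔-refl
    ; commutes = λ { (x , false) → refl ; (x , true) → cong (_, false) (ψ∘τ≡υ∘ψ x) } }

module _ {P : Set} {σ : P → P} where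

  alternating-reindex : ∀ {X Y} → X ↔ Y → Alternating σ X → Alternating σ Y
  alternating-reindex ψ A = record
    { step      = ↔-trans (↔-sym ψ) (↔-trans (step A) ψ)
    ; colouring = conj-trans (colouring A) (alternate-conj ψ λ x →
        sym (cong (λ x′ → to ψ (to (step A) x′)) (strictlyInverseʳ ψ x))) }

alternating-⊎ : ∀ {P Q X Y : Set} {σ : P → P} {τ : Q → Q} →
                Alternating σ X → Alternating τ Y → Alternating (Sum.map σ τ) (X ⊎ Y)
alternating-⊎ A B = record
  { step      = step A ⊎-↔ step B
  ; colouring = conj-trans (conj-⊎ (colouring A) (colouring B)) alternate-⊎ }

alternating-even : ∀ ms → All (2 ∣_) ms → ∃ λ h → h * 2 ≡ sum ms × Alternating (rotate ms) (Fin h)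
alternating-even []       []                = 0 , refl , alternating-∅ λ ()
alternating-even (m ∷ ms) (divides q refl ∷ 2∣ms) =
  let h , h*2≡sum , A = alternating-even ms 2∣ms in
  q + h , trans (*-distribʳ-+ 2 q h) (cong (q * 2 +_) h*2≡sum) ,
  alternating-reindex (↔-sym +↔⊎) (alternating-⊎ (alternating-cycle q) A)

alternating-conj : ∀ {P Q X : Set} {σ : P → P} {σ′ : Q → Q} →
                   Conjugacy σ′ σ → Alternating σ X → Alternating σ′ X
alternating-conj c A = record { step = step A ; colouring = conj-trans c (colouring A) }

module Doubling {PA PB X T : Set} {σA : PA → PA} {σB : PB → PB}
  (DA : Decomposition PA σA X T) (DB : Decomposition PB σB X T)
  (A : Alternating (Sum.map σA σB) X) (L : LatinSquare X) where

  open LatinSquare L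

  σ : PA ⊎ PB → PA ⊎ PB
  σ = Sum.map σA σB

  τ : X → X
  τ = to (step A)

  colour : (PA ⊎ PB) ↔ (X × Bool)
  colour = iso (colouring A)

  shiftSecond : X → X × Bool → X × Bool
  shiftSecond d (x , false) = x , false
  shiftSecond d (x , true)  = to (row d) x , true

  shiftSecond↔ : X → (X × Bool) ↔ (X × Bool)
  shiftSecond↔ d = mk↔ₛ′ (shiftSecond d) unshift
    (λ { (x , false) → refl ; (x , true) → cong (_, true) (strictlyInverseˡ (row d) x) })
    (λ { (x , false) → refl ; (x , true) → cong (_, true) (strictlyInverseʳ (row d) x) })
    where
    unshift : X × Bool → X × Bool
    unshift (x , false) = x , false
    unshift (x , true)  = from (row d) x , true

  level : T → (PA ⊎ PB) ↔ (X × Bool)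
  level s = ↔-trans (factor DA s ⊎-↔ factor DB s) copies
    where
    copies : (X ⊎ X) ↔ (X × Bool)
    copies = mk↔ₛ′ [ (_, false) , (_, true) ] (λ { (x , false) → inj₁ x ; (x , true) → inj₂ x })
                   (λ { (x , false) → refl ; (x , true) → refl }) (λ { (inj₁ x) → refl ; (inj₂ x) → refl })

  cross : X → (PA ⊎ PB) ↔ (X × Bool)
  cross d = ↔-trans colour (shiftSecond↔ d)

  level-σ : ∀ s p → proj₂ (to (level s) (σ p)) ≡ proj₂ (to (level s) p)
  level-σ s (inj₁ p) = refl
  level-σ s (inj₂ p) = refl

  cross-σ : ∀ d p → to (cross d) (σ p) ≡ shiftSecond d (alternate τ (to colour p))
  cross-σ d p = cong (shiftSecond d) (commutes (colouring A) p)

  cross-σ-flips : ∀ d p → proj₂ (to (cross d) (σ p)) ≡ not (proj₂ (to (cross d) p))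
  cross-σ-flips d p = trans (cong proj₂ (cross-σ d p)) (flips (to colour p))
    where
    flips : ∀ c → proj₂ (shiftSecond d (alternate τ c)) ≡ not (proj₂ (shiftSecond d c))
    flips (x , false) = refl
    flips (x , true)  = refl

  cross-at-colour : ∀ d c → to (cross d) (from colour c) ≡ shiftSecond d c ×
                            to (cross d) (σ (from colour c)) ≡ shiftSecond d (alternate τ c)
  cross-at-colour d c = cong (shiftSecond d) (strictlyInverseˡ colour c) ,
                        trans (cross-σ d (from colour c))
                              (cong (λ c′ → shiftSecond d (alternate τ c′)) (strictlyInverseˡ colour c))

  -- The end of the arc in the first copy determines x (through step when it is the head),
  -- and then the Latin square determines d.
  shiftSecond-arc-injective : ∀ d d′ c c′ → shiftSecond d c ≡ shiftSecond d′ c′ →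
    shiftSecond d (alternate τ c) ≡ shiftSecond d′ (alternate τ c′) → d ≡ d′
  shiftSecond-arc-injective d d′ (x , false) (.x , false) refl e′ = column-injective x (cong proj₁ e′)
  shiftSecond-arc-injective d d′ (x , true)  (x′ , true)  e    e′
    with to-injective (step A) (cong proj₁ e′)
  ... | refl = column-injective x (cong proj₁ e)

  doubled-factor : T ⊎ X → (PA ⊎ PB) ↔ (X × Bool)
  doubled-factor = [ level , cross ]

  doubled-loopless : ∀ s p → to (doubled-factor s) p ≢ to (doubled-factor s) (σ p)
  doubled-loopless (inj₁ s) (inj₁ p) e = loopless DA s p (cong proj₁ e)
  doubled-loopless (inj₁ s) (inj₂ p) e = loopless DB s p (cong proj₁ e)
  doubled-loopless (inj₂ d) p        e = not-¬ refl (trans (cong proj₂ e) (cross-σ-flips d p))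

  doubled-covers : ∀ {u v} → u ≢ v →
                   ∃₂ λ s p → to (doubled-factor s) p ≡ u × to (doubled-factor s) (σ p) ≡ v
  doubled-covers {x , false} {y , false} u≢v =
    let s , p , p↦x , σp↦y = covers DA (u≢v ∘ cong (_, false)) in
    inj₁ s , inj₁ p , cong (_, false) p↦x , cong (_, false) σp↦y
  doubled-covers {x , true}  {y , true}  u≢v =
    let s , p , p↦x , σp↦y = covers DB (u≢v ∘ cong (_, true)) in
    inj₁ s , inj₂ p , cong (_, true) p↦x , cong (_, true) σp↦y
  doubled-covers {x , false} {y , true}  _ =
    let d , x↦y = column-surjective x y ; p↦u , σp↦v = cross-at-colour d (x , false) in
    inj₂ d , from colour (x , false) , p↦u , trans σp↦v (cong (_, true) x↦y)
  doubled-covers {y , true}  {z , false} _ =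
    let x = from (step A) z ; d , x↦y = column-surjective x y
        p↦u , σp↦v = cross-at-colour d (x , true) in
    inj₂ d , from colour (x , true) , trans p↦u (cong (_, true) x↦y) ,
    trans σp↦v (cong (_, false) (strictlyInverseˡ (step A) z))

  level-cross-disjoint : ∀ s d p p′ → to (level s) p ≡ to (cross d) p′ →
                         to (level s) (σ p) ≡ to (cross d) (σ p′) → ⊥
  level-cross-disjoint s d p p′ e e′ =
    not-¬ (cong proj₂ e) (trans (sym (level-σ s p)) (trans (cong proj₂ e′) (cross-σ-flips d p′)))

  doubled-disjoint : ∀ {s s′ p p′} → to (doubled-factor s) p ≡ to (doubled-factor s′) p′ →
                     to (doubled-factor s) (σ p) ≡ to (doubled-factor s′) (σ p′) → s ≡ s′
  doubled-disjoint {inj₁ s} {inj₁ s′} {inj₁ p} {inj₁ p′} e e′ =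
    cong inj₁ (disjoint DA (cong proj₁ e) (cong proj₁ e′))
  doubled-disjoint {inj₁ s} {inj₁ s′} {inj₂ p} {inj₂ p′} e e′ =
    cong inj₁ (disjoint DB (cong proj₁ e) (cong proj₁ e′))
  doubled-disjoint {inj₁ s} {inj₁ s′} {inj₁ p} {inj₂ p′} () e′
  doubled-disjoint {inj₁ s} {inj₁ s′} {inj₂ p} {inj₁ p′} () e′
  doubled-disjoint {inj₁ s} {inj₂ d′} {p} {p′} e e′ = ⊥-elim (level-cross-disjoint s d′ p p′ e e′)
  doubled-disjoint {inj₂ d} {inj₁ s′} {p} {p′} e e′ = ⊥-elim (level-cross-disjoint s′ d p′ p (sym e) (sym e′))
  doubled-disjoint {inj₂ d} {inj₂ d′} {p} {p′} e e′ = cong inj₂ (shiftSecond-arc-injective d d′ _ _ e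
    (trans (sym (cross-σ d p)) (trans e′ (cross-σ d′ p′))))

  doubled : Decomposition (PA ⊎ PB) σ (X × Bool) (T ⊎ X)
  doubled = record { factor   = doubled-factor   ; loopless = doubled-loopless
                   ; covers   = doubled-covers   ; disjoint = doubled-disjoint }

OPStar-empty : ∀ ms → sum ms ≡ 0 → OPStar ms
OPStar-empty ms sum≡0 = 0 , (λ ()) , (λ ()) , λ u _ _ → ⊥-elim (¬Fin0 (subst Fin sum≡0 u))

OPStar-++ : ∀ {n} A B → sum A ≡ n → sum B ≡ n → All (2 ∣_) A → All (2 ∣_) B →
            OPStar A → OPStar B → OPStar (A ++ B)
OPStar-++ {zero}  A B sumA≡0 sumB≡0 _ _ _ _ =
  OPStar-empty (A ++ B) (trans (sum-++ A B) (cong₂ _+_ sumA≡0 sumB≡0))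
OPStar-++ {suc k} A B sumA≡n sumB≡n evenA evenB opA opB
  with OPStar⇒Decomposition A opA | OPStar⇒Decomposition B opB
... | tA , DA | tB , DB =
  Decomposition⇒OPStar (A ++ B)
    (relabel (reindex (reposition doubled (Cycles-++ A B)) (↔-sym +↔⊎)) copies↔Fin)
  where
  n : ℕ
  n = suc k

  sum[A++B]≡n*2 : sum (A ++ B) ≡ n * 2
  sum[A++B]≡n*2 = trans (sum-++ A B) (trans (cong₂ _+_ sumA≡n sumB≡n) (m+m≡m*2 n))
    where
    m+m≡m*2 : ∀ m → m + m ≡ m * 2
    m+m≡m*2 = solve-∀

  DA′ : Decomposition (Cycles A) (rotate A) (Fin n) (Fin tA)
  DA′ = relabel DA (cast-id sumA≡n)

  DB′ : Decomposition (Cycles B) (rotate B) (Fin n) (Fin tB)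
  DB′ = relabel DB (cast-id sumB≡n)

  tB≡tA : tB ≡ tA
  tB≡tA = factorCount-unique DB′ DA′ (↔-trans (Cycles↔Fin B) (cast-id sumB≡n))
                                     (↔-trans (Cycles↔Fin A) (cast-id sumA≡n))

  alternating : Alternating (Sum.map (rotate A) (rotate B)) (Fin n)
  alternating with alternating-even (A ++ B) (++⁺ evenA evenB)
  ... | h , h*2≡sum , alt =
    alternating-reindex (cast-id (*-cancelʳ-≡ h n 2 (trans h*2≡sum sum[A++B]≡n*2)))
                        (alternating-conj (conj-sym (Cycles-++ A B)) alt)

  open Doubling DA′ (reindex DB′ (cast-id tB≡tA)) alternating (Cyclic.cyclicLatinSquare k) using (doubled)

  copies↔Fin : (Fin n × Bool) ↔ Fin (sum (A ++ B))
  copies↔Fin = ↔-trans (↔-refl ×-↔ ↔-sym 2↔Bool) (↔-trans (↔-sym *↔×) (cast-id (sym sum[A++B]≡n*2)))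

record EvenSolvable (n : ℕ) (ms : List ℕ) : Set where
  constructor evenSolvable
  field
    sum≡     : sum ms ≡ n
    even     : All (2 ∣_) ms
    solution : OPStar ms

EvenSolvable-++ : ∀ {n A B} → EvenSolvable n A → EvenSolvable n B → EvenSolvable (n + n) (A ++ B)
EvenSolvable-++ {A = A} {B} SA SB = record
  { sum≡     = trans (sum-++ A B) (cong₂ _+_ (sum≡ SA) (sum≡ SB))
  ; even     = ++⁺ (even SA) (even SB)
  ; solution = OPStar-++ A B (sum≡ SA) (sum≡ SB) (even SA) (even SB) (solution SA) (solution SB) }
  where open EvenSolvable

length-halves : ∀ {A : Set} m (xs : List A) → length xs ≡ m + m →
                length (take m xs) ≡ m × length (drop m xs) ≡ m
length-halves m xs len≡m+m =
  trans (length-take m xs) (trans (cong (m ⊓_) len≡m+m) (m≤n⇒m⊓n≡m (m≤m+n m m))) ,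
  trans (length-drop m xs) (trans (cong (_∸ m) len≡m+m) (m+n∸m≡n m m))

EvenSolvable-concat : ∀ a {n} Ps → length Ps ≡ 2 ^ a → All (EvenSolvable n) Ps →
                      EvenSolvable (2 ^ a * n) (concat Ps)
EvenSolvable-concat zero    {n} (P ∷ []) _ (S ∷ []) =
  subst₂ EvenSolvable (sym (+-identityʳ n)) (sym (++-identityʳ P)) S
EvenSolvable-concat (suc a) {n} Ps len Ss =
  subst₂ EvenSolvable (m*n+m*n≡2m*n m n)
         (trans (concat-++ (take m Ps) (drop m Ps)) (cong concat (take++drop≡id m Ps)))
         (EvenSolvable-++ (EvenSolvable-concat a (take m Ps) (proj₁ halves) (take⁺ m Ss))
                          (EvenSolvable-concat a (drop m Ps) (proj₂ halves) (drop⁺ m Ss)))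
  where
  m : ℕ
  m = 2 ^ a
  m*n+m*n≡2m*n : ∀ m n → m * n + m * n ≡ (2 * m) * n
  m*n+m*n≡2m*n = solve-∀
  halves : length (take m Ps) ≡ m × length (drop m Ps) ≡ m
  halves = length-halves m Ps (trans len (cong (m +_) (+-identityʳ m)))

All-toList : ∀ {A : Set} {P : A → Set} {k} (v : Vec A k) → (∀ i → P (lookup v i)) → All P (toList v)
All-toList []      Pv = []
All-toList (x ∷ v) Pv = Pv zero ∷ All-toList v (Pv ∘ suc)

commonSum : ∀ {k} (Ps : Vec (List ℕ) k) → (∀ i j → sum (lookup Ps i) ≡ sum (lookup Ps j)) →
            ∃ λ n → All (λ P → sum P ≡ n) (toList Ps)
commonSum []       _     = 0 , []
commonSum (P ∷ Ps) equal = sum P , All-toList (P ∷ Ps) (λ i → equal i zero)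

corollary4p2 : (ms : List ℕ) →
    All (λ m → 0 < m × 2 ∣ m) ms →
    (a : ℕ) → 0 < a →
    (Ps : Vec (List ℕ) (2 ^ a)) →
    concat (toList Ps) ↭ ms →
    (∀ i j → sum (lookup Ps i) ≡ sum (lookup Ps j)) →
    (∀ i → OPStar (lookup Ps i)) →
    OPStar ms
corollary4p2 ms allEven a _ Ps Ps↭ms equalSums solutions =
  OPStar-resp-↭ Ps↭ms (EvenSolvable.solution (EvenSolvable-concat a (toList Ps) (length-toList Ps) blocks))
  where
  n : ℕ
  n = proj₁ (commonSum Ps equalSums)

  blocks : All (EvenSolvable n) (toList Ps)
  blocks = All.zipWith (λ ((sum≡n , even) , solution) → evenSolvable sum≡n even solution)
    (All.zip (proj₂ (commonSum Ps equalSums) ,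
              concat⁻ (All-resp-↭ (↭.↭-sym Ps↭ms) (All.map proj₂ allEven))) ,
     All-toList Ps solutions)
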